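{- Let $(W,S)$ be a finite Coxeter system and $A\subseteq T$. The following are equivalent: (1) $\mathcal{D}_A(W)$ is a subalgebra of $\mathbb{Z}W$; (2) for all $I,J\in\mathcal{P}_{\mathrm{ad}}(A)$ and all $w,w'\in W$ with $D_A(w)=D_A(w')$, one has $|D_A(I,J,w)|=|D_A(I,J,w')|$. Moreover, if these conditions hold and for each $I\in\mathcal{P}_{\mathrm{ad}}(A)$ an element $z_I\in D_I^A$ is chosen, then for all $I,J\in\mathcal{P}_{\mathrm{ad}}(A)$, $$d_I^Ad_J^A=\sum_{K\in\mathcal{P}_{\mathrm{ad}}(A)}|D_A(I,J,z_K)|\,d_K^A.$$
   Context: $\ell$ is the length function, $T=\{wsw^{ -1}\mid w\in W,s\in S\}$, $D_A(w)=\{r\in A\mid\ell(wr)<\ell(w)\}$; $\mathcal{P}_{\mathrm{ad}}(A)$ is the set of $I\subseteq A$ with $I=D_A(w)$ for some $w\in W$; for such $I$, $D_I^A=\{w\mid D_A(w)=I\}$, $d_I^A=\sum_{w\in D_I^A}w$, and $\mathcal{D}_A(W)=\bigoplus_{I\in\mathcal{P}_{\mathrm{ad}}(A)}\mathbb{Z}d_I^A\subseteq\mathbb{Z}W$. For $I,J\in\mathcal{P}_{\mathrm{ad}}(A)$ and $w\in W$, $D_A(I,J,w)=\{(u,v)\in D_I^A\times D_J^A\mid uv=w\}$. A subalgebra need not contain $1$. -}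

module Defs where

open import Level using (0ℓ)
open import Data.Bool using (Bool; true; false; _∧_; if_then_else_)
open import Data.Nat using (ℕ; zero; suc; _≤_; _<ᵇ_)
open import Data.Integer using (ℤ; 0ℤ; 1ℤ; _+_; _*_; -_)
open import Data.List using (List; []; _∷_; length; filter; foldr; map; cartesianProduct; deduplicateᵇ)
open import Data.List.Membership.Propositional using (_∈_)
open import Data.List.Relation.Unary.All using (All)
open import Data.List.Relation.Unary.Unique.Propositional using (Unique)
open import Data.Product using (Σ; ∃; _×_; _,_; proj₁; proj₂)
open import Relation.Binary.PropositionalEquality using (_≡_; _≢_)
open import Relation.Binary.Definitions using (DecidableEquality)
open import Relation.Nullary using (Dec; ¬_)
open import Algebra.Structures using (IsGroup)
open import Algebra.Bundles using (Group)

record FiniteGroup : Set₁ where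
  field
    Carrier  : Set
    _·_      : Carrier → Carrier → Carrier
    e        : Carrier
    _⁻¹      : Carrier → Carrier
    isGroup  : IsGroup _≡_ _·_ e _⁻¹
    _≟_      : DecidableEquality Carrier
    elems    : List Carrier
    complete : ∀ x → x ∈ elems
    unique   : Unique elems

  infixl 7 _·_

  prod : List Carrier → Carrier
  prod = foldr _·_ e

  pow : Carrier → ℕ → Carrier
  pow x zero    = e
  pow x (suc n) = x · pow x n

gpow : (H : Group 0ℓ 0ℓ) → Group.Carrier H → ℕ → Group.Carrier H
gpow H x zero    = Group.ε H
gpow H x (suc n) = Group._∙_ H x (gpow H x n)

-- Finite Coxeter systems (W,S), defined by the Coxeter presentation:
-- S ⊆ W consists of involutions, generates W, and every map f from S to
-- a group H satisfying the relations (f s f t)^n = 1 whenever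
-- (s t)^n = 1 in W (i.e. the relations (st)^{m(s,t)} = 1) extends to a
-- group homomorphism W → H.  The field ℓ is the length function with
-- respect to S (it is uniquely determined by its specification).

record FiniteCoxeterSystem : Set₁ where
  field
    W : FiniteGroup
  open FiniteGroup W public
  field
    S          : List Carrier
    S-unique   : Unique S
    S-invol    : ∀ {s} → s ∈ S → s · s ≡ e
    S-nontriv  : ∀ {s} → s ∈ S → s ≢ e
    S-generate : ∀ w → Σ (List Carrier) λ ws → All (_∈ S) ws × prod ws ≡ w
    presentation :
      (H : Group 0ℓ 0ℓ) (f : Carrier → Group.Carrier H) →
      (∀ {s t} → s ∈ S → t ∈ S → ∀ n → pow (s · t) n ≡ e →
         Group._≈_ H (gpow H (Group._∙_ H (f s) (f t)) n) (Group.ε H)) →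
      Σ (Carrier → Group.Carrier H) λ φ →
        (∀ x y → Group._≈_ H (φ (x · y)) (Group._∙_ H (φ x) (φ y))) ×
        (∀ {s} → s ∈ S → Group._≈_ H (φ s) (f s))
    ℓ          : Carrier → ℕ
    ℓ-word     : ∀ w → Σ (List Carrier) λ ws →
                   All (_∈ S) ws × prod ws ≡ w × length ws ≡ ℓ w
    ℓ-minimal  : ∀ w (ws : List Carrier) → All (_∈ S) ws → prod ws ≡ w →
                   ℓ w ≤ length ws

module Descents (C : FiniteCoxeterSystem) where
  open FiniteCoxeterSystem C

  Subset : Set
  Subset = Carrier → Bool

  _∈ᵇ_ : Carrier → Subset → Set
  x ∈ᵇ X = X x ≡ true

  IsReflection : Carrier → Set
  IsReflection r = Σ Carrier λ w → Σ Carrier λ s → s ∈ S × r ≡ (w · s) · (w ⁻¹)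

  _⊆T : Subset → Set
  A ⊆T = ∀ r → r ∈ᵇ A → IsReflection r

  _==_ : Bool → Bool → Bool
  true  == b = b
  false == true  = false
  false == false = true

  _≗ᵇ_ : Subset → Subset → Bool
  X ≗ᵇ Y = foldr (λ r acc → (X r == Y r) ∧ acc) true elems

  _≗_ : Subset → Subset → Set
  X ≗ Y = ∀ r → X r ≡ Y r

  D : Subset → Carrier → Subset
  D A w r = A r ∧ (ℓ (w · r) <ᵇ ℓ w)

  IsAdmissible : Subset → Subset → Set
  IsAdmissible A I = Σ Carrier λ w → D A w ≗ I

  inDI : Subset → Subset → Carrier → Bool
  inDI A I w = D A w ≗ᵇ I

  ℤW : Set
  ℤW = Carrier → ℤ

  ΣW : (Carrier → ℤ) → ℤ
  ΣW f = foldr (λ u acc → f u + acc) 0ℤ elems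

  _≈_ : ℤW → ℤW → Set
  f ≈ g = ∀ w → f w ≡ g w

  0W : ℤW
  0W _ = 0ℤ

  _⊕_ : ℤW → ℤW → ℤW
  (f ⊕ g) w = f w + g w

  _•_ : ℤ → ℤW → ℤW
  (c • f) w = c * f w

  _⊛_ : ℤW → ℤW → ℤW
  (f ⊛ g) w = ΣW λ u → f u * g ((u ⁻¹) · w)

  -- d_I^A = Σ_{w ∈ D_I^A} w
  d : Subset → Subset → ℤW
  d A I w = if inDI A I w then 1ℤ else 0ℤ

  -- 𝒟_A(W) = ℤ-span of { d_I^A | I ∈ P_ad(A) } = span of { d_{D_A(w)}^A | w ∈ W }
  In𝒟 : Subset → ℤW → Set
  In𝒟 A f = Σ (Carrier → ℤ) λ c → f ≈ (λ x → ΣW λ w → (c w • d A (D A w)) x)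

  -- subalgebra (not necessarily containing 1) of ℤW
  IsSubalgebra : (ℤW → Set) → Set
  IsSubalgebra P =
    (∀ {f g} → f ≈ g → P f → P g) ×
    P 0W ×
    (∀ {f g} → P f → P g → P (f ⊕ g)) ×
    (∀ c {f} → P f → P (c • f)) ×
    (∀ {f g} → P f → P g → P (f ⊛ g))

  countIJ : Subset → Subset → Subset → Carrier → ℕ
  countIJ A I J w =
    length (filter λ-test (cartesianProduct elems elems))
    where
      open import Relation.Nullary.Decidable using (_×-dec_)
      open import Data.Bool.Properties using () renaming (_≟_ to _≟B_)
      λ-test : (p : Carrier × Carrier) → Dec (inDI A I (proj₁ p) ≡ true × (inDI A J (proj₂ p) ≡ true × proj₁ p · proj₂ p ≡ w))
      λ-test (u , v) = (inDI A I u ≟B true) ×-dec ((inDI A J v ≟B true) ×-dec ((u · v) ≟ w))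

  PadList : Subset → List Subset
  PadList A = deduplicateᵇ _≗ᵇ_ (map (D A) elems)

  ΣL : List Subset → (Subset → ℤW) → ℤW
  ΣL Ks F x = foldr (λ K acc → F K x + acc) 0ℤ Ks

-- The span 𝒟_A(W) of the d_I^A is exactly the set of functions W → ℤ that are constant on
-- the classes {w | D_A(w) = I}: as coefficients take the values at one representative per
-- class.  So 𝒟_A(W) is always a ℤ-submodule of ℤW, and by bilinearity of the product it is
-- a subalgebra iff every d_I^A d_J^A is constant on these classes.  The coefficient of w in
-- d_I^A d_J^A is |D_A(I,J,w)|, which gives the equivalence; expanding the class function
-- d_I^A d_J^A in the basis (d_K^A) gives the product formula.  Nothing specific to Coxeter
-- groups is used, in particular not A ⊆ T.

module Submission where

open import Defs
open import Data.Bool using (Bool; T; true; false; not; _∧_; if_then_else_)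
open import Data.Integer using (ℤ; +_; 0ℤ; 1ℤ; _+_; _*_)
open import Data.Integer.Properties
  using (+-identityˡ; +-identityʳ; +-assoc; *-identityˡ; *-identityʳ; *-zeroʳ; *-assoc;
         *-distribˡ-+; *-distribʳ-+; +-injective; +-commutativeSemigroup; *-commutativeSemigroup)
open import Data.List
  using (List; []; _∷_; _++_; length; filter; foldr; map; cartesianProduct; deduplicateᵇ; findᵇ)
open import Data.List.Properties using (foldr-cong)
open import Data.List.Membership.Propositional using (_∈_)
open import Data.List.Relation.Unary.Any as Any using (Any; here; there)
open import Data.List.Relation.Unary.Any.Properties using (map⁺)
open import Data.List.Relation.Unary.All as All using (All; []; _∷_)
open import Data.List.Relation.Unary.Unique.Propositional using (Unique)
open import Data.List.Relation.Unary.AllPairs using ([]; _∷_)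
open import Data.Maybe using (just)
open import Data.Maybe.Properties using (just-injective)
open import Data.Product using (∃-syntax; _×_; _,_; proj₁; proj₂)
open import Data.Empty using (⊥-elim)
open import Function using (_∘_; case_of_)
open import Function.Bundles using (_⇔_; mk⇔)
open import Relation.Binary.PropositionalEquality hiding (_≗_)
open ≡-Reasoning
open import Relation.Nullary using (Dec; yes; no; ¬_; does)
open import Relation.Nullary.Decidable using (dec-true; dec-false; ¬?; T?)
open import Relation.Unary using (Pred; Decidable)
import Algebra.Properties.CommutativeSemigroup as CommSemigroupProperties
import Algebra.Properties.Group as GroupProperties
open import Algebra.Bundles using (Group)
open import Level using (0ℓ)

open CommSemigroupProperties +-commutativeSemigroup using () renaming (interchange to +-interchange)
open CommSemigroupProperties *-commutativeSemigroup using () renaming (x∙yz≈y∙xz to *-left-comm)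

ind : Bool → ℤ
ind b = if b then 1ℤ else 0ℤ

module _ {X : Set} where

  ∑ : List X → (X → ℤ) → ℤ
  ∑ xs f = foldr (λ x acc → f x + acc) 0ℤ xs

  ∑-cong : ∀ xs {f g : X → ℤ} → (∀ x → f x ≡ g x) → ∑ xs f ≡ ∑ xs g
  ∑-cong xs f≗g = foldr-cong (λ x acc → cong (_+ acc) (f≗g x)) refl xs

  ∑-zero : ∀ {xs} {f : X → ℤ} → All (λ x → f x ≡ 0ℤ) xs → ∑ xs f ≡ 0ℤ
  ∑-zero []           = refl
  ∑-zero (fx≡0 ∷ f≡0) = cong₂ _+_ fx≡0 (∑-zero f≡0)

  ∑-++ : ∀ xs ys f → ∑ (xs ++ ys) f ≡ ∑ xs f + ∑ ys f
  ∑-++ []       ys f = sym (+-identityˡ _)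
  ∑-++ (x ∷ xs) ys f = trans (cong (_+_ (f x)) (∑-++ xs ys f)) (sym (+-assoc (f x) _ _))

  ∑-+ : ∀ xs f g → ∑ xs (λ x → f x + g x) ≡ ∑ xs f + ∑ xs g
  ∑-+ []       f g = refl
  ∑-+ (x ∷ xs) f g = trans (cong (_+_ (f x + g x)) (∑-+ xs f g)) (+-interchange (f x) (g x) _ _)

  ∑-*ˡ : ∀ a xs f → a * ∑ xs f ≡ ∑ xs (λ x → a * f x)
  ∑-*ˡ a []       f = *-zeroʳ a
  ∑-*ˡ a (x ∷ xs) f = trans (*-distribˡ-+ a (f x) _) (cong (_+_ (a * f x)) (∑-*ˡ a xs f))

  ∑-*ʳ : ∀ a xs f → ∑ xs f * a ≡ ∑ xs (λ x → f x * a)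
  ∑-*ʳ a []       f = refl
  ∑-*ʳ a (x ∷ xs) f = trans (*-distribʳ-+ a (f x) _) (cong (_+_ (f x * a)) (∑-*ʳ a xs f))

  ∑-single : ∀ {xs} {f : X → ℤ} a → Unique xs → a ∈ xs → (∀ x → x ≢ a → f x ≡ 0ℤ) → ∑ xs f ≡ f a
  ∑-single {f = f} a (a∉xs ∷ _) (here refl) f≡0 =
    trans (cong (_+_ (f a)) (∑-zero (All.map (λ a≢x → f≡0 _ (a≢x ∘ sym)) a∉xs))) (+-identityʳ _)
  ∑-single {x ∷ xs} {f} a (x∉xs ∷ unique) (there a∈xs) f≡0 =
    trans (cong (_+ ∑ xs f) (f≡0 x (All.lookup x∉xs a∈xs)))
          (trans (+-identityˡ _) (∑-single a unique a∈xs f≡0))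

  length-filter-∑ : ∀ {p} {P : Pred X p} (P? : Decidable P) xs →
                    + length (filter P? xs) ≡ ∑ xs (λ x → ind (does (P? x)))
  length-filter-∑ P? []       = refl
  length-filter-∑ P? (x ∷ xs) with does (P? x)
  ... | true  = cong (_+_ 1ℤ) (length-filter-∑ P? xs)
  ... | false = trans (length-filter-∑ P? xs) (sym (+-identityˡ _))

  ∑-filter : ∀ {p} {P : Pred X p} (P? : Decidable P) xs f →
             ∑ (filter P? xs) f ≡ ∑ xs (λ x → ind (does (P? x)) * f x)
  ∑-filter P? []       f = refl
  ∑-filter P? (x ∷ xs) f with does (P? x)
  ... | true  = cong₂ _+_ (sym (*-identityˡ (f x))) (∑-filter P? xs f)
  ... | false = trans (∑-filter P? xs f) (sym (+-identityˡ _))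

  findᵇ-cong : ∀ {p q : X → Bool} → (∀ x → p x ≡ q x) → ∀ xs → findᵇ p xs ≡ findᵇ q xs
  findᵇ-cong p≗q []       = refl
  findᵇ-cong p≗q (x ∷ xs) rewrite p≗q x | findᵇ-cong p≗q xs = refl

  findᵇ-just : ∀ (p : X → Bool) {xs} → Any (λ x → p x ≡ true) xs →
               ∃[ y ] findᵇ p xs ≡ just y × p y ≡ true
  findᵇ-just p {x ∷ xs} any with p x in px | any
  ... | true  | _          = x , refl , px
  ... | false | here px′ with () ← trans (sym px) px′
  ... | false | there any′ = findᵇ-just p any′

  module _ (R : X → X → Bool)
           (R-sym : ∀ {x y} → R x y ≡ true → R y x ≡ true)
           (R-trans : ∀ {x y z} → R x y ≡ true → R y z ≡ true → R x z ≡ true) where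

    private
      -- the filter that deduplicateᵇ R (x ∷ xs) applies to the deduplicated tail
      notRelated : ∀ x y → Dec (¬ T (R x y))
      notRelated x y = ¬? (T? (R x y))

    ∑-deduplicateᵇ-class : ∀ c xs → Any (λ x → R c x ≡ true) xs →
                           ∑ (deduplicateᵇ R xs) (ind ∘ R c) ≡ 1ℤ
    ∑-deduplicateᵇ-class c (x ∷ xs) any with R c x in cx | any
    ... | true  | _          = cong (_+_ 1ℤ) (begin
      ∑ (filter (notRelated x) rest) (ind ∘ R c)       ≡⟨ ∑-filter (notRelated x) rest (ind ∘ R c) ⟩
      ∑ rest (λ y → ind (not (R x y)) * ind (R c y))   ≡⟨ ∑-zero (All.universal removed rest) ⟩
      0ℤ                                               ∎)
      where
      rest : List X
      rest = deduplicateᵇ R xs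
      removed : ∀ y → ind (not (R x y)) * ind (R c y) ≡ 0ℤ
      removed y with R c y in cy
      ... | true  rewrite R-trans (R-sym cx) cy = refl
      ... | false = *-zeroʳ (ind (not (R x y)))
    ... | false | here cx′   with () ← trans (sym cx) cx′
    ... | false | there any′ = begin
      0ℤ + ∑ (filter (notRelated x) rest) (ind ∘ R c)  ≡⟨ +-identityˡ _ ⟩
      ∑ (filter (notRelated x) rest) (ind ∘ R c)       ≡⟨ ∑-filter (notRelated x) rest (ind ∘ R c) ⟩
      ∑ rest (λ y → ind (not (R x y)) * ind (R c y))   ≡⟨ ∑-cong rest kept ⟩
      ∑ rest (ind ∘ R c)                               ≡⟨ ∑-deduplicateᵇ-class c xs any′ ⟩
      1ℤ                                               ∎
      where
      rest : List X
      rest = deduplicateᵇ R xs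
      kept : ∀ y → ind (not (R x y)) * ind (R c y) ≡ ind (R c y)
      kept y with R c y in cy | R x y in xy
      ... | true  | false = refl
      ... | true  | true  with () ← trans (sym cx) (R-trans cy (R-sym xy))
      ... | false | xy′   = *-zeroʳ (ind (not xy′))

∑-map : ∀ {X Y : Set} (g : X → Y) xs f → ∑ (map g xs) f ≡ ∑ xs (λ x → f (g x))
∑-map g []       f = refl
∑-map g (x ∷ xs) f = cong (_+_ (f (g x))) (∑-map g xs f)

module _ {X Y : Set} where

  ∑-cartesianProduct : ∀ xs ys (f : X × Y → ℤ) →
                       ∑ (cartesianProduct xs ys) f ≡ ∑ xs (λ x → ∑ ys (λ y → f (x , y)))
  ∑-cartesianProduct []       ys f = refl
  ∑-cartesianProduct (x ∷ xs) ys f =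
    trans (∑-++ (map (x ,_) ys) _ f) (cong₂ _+_ (∑-map (x ,_) ys f) (∑-cartesianProduct xs ys f))

  ∑-comm : ∀ xs ys (f : X → Y → ℤ) → ∑ xs (λ x → ∑ ys (f x)) ≡ ∑ ys (λ y → ∑ xs (λ x → f x y))
  ∑-comm []       ys f = sym (∑-zero (All.universal (λ _ → refl) ys))
  ∑-comm (x ∷ xs) ys f =
    trans (cong (_+_ (∑ ys (f x))) (∑-comm xs ys f)) (sym (∑-+ ys (f x) (λ y → ∑ xs (λ x → f x y))))

module SubsetEquality (C : FiniteCoxeterSystem) where
  open FiniteCoxeterSystem C
  open Descents C

  ==⇒≡ : ∀ a b → (a == b) ≡ true → a ≡ b
  ==⇒≡ true  true  _ = refl
  ==⇒≡ false false _ = refl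
  ==⇒≡ true  false ()
  ==⇒≡ false true  ()

  ==-refl : ∀ a → (a == a) ≡ true
  ==-refl true  = refl
  ==-refl false = refl

  private
    agreeOn : Subset → Subset → List Carrier → Bool
    agreeOn X Y = foldr (λ r acc → (X r == Y r) ∧ acc) true

    agreeOn-sound : ∀ {X Y} rs → agreeOn X Y rs ≡ true → All (λ r → X r ≡ Y r) rs
    agreeOn-sound             []       _ = []
    agreeOn-sound {X} {Y} (r ∷ rs) agree with X r == Y r in eq | agree
    ... | true | agree′ = ==⇒≡ (X r) (Y r) eq ∷ agreeOn-sound rs agree′

    agreeOn-complete : ∀ {X Y} → X ≗ Y → ∀ rs → agreeOn X Y rs ≡ true
    agreeOn-complete         X≗Y []       = refl
    agreeOn-complete {Y = Y} X≗Y (r ∷ rs) rewrite X≗Y r | ==-refl (Y r) = agreeOn-complete X≗Y rs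

  ≗ᵇ⇒≗ : ∀ X Y → (X ≗ᵇ Y) ≡ true → X ≗ Y
  ≗ᵇ⇒≗ X Y X≗ᵇY r = All.lookup (agreeOn-sound {X} {Y} elems X≗ᵇY) (complete r)

  ≗⇒≗ᵇ : ∀ {X Y} → X ≗ Y → (X ≗ᵇ Y) ≡ true
  ≗⇒≗ᵇ X≗Y = agreeOn-complete X≗Y elems

  ≗-sym : ∀ {X Y} → X ≗ Y → Y ≗ X
  ≗-sym X≗Y r = sym (X≗Y r)

  ≗-trans : ∀ {X Y Z} → X ≗ Y → Y ≗ Z → X ≗ Z
  ≗-trans X≗Y Y≗Z r = trans (X≗Y r) (Y≗Z r)

  ≗ᵇ-refl : ∀ X → (X ≗ᵇ X) ≡ true
  ≗ᵇ-refl X = ≗⇒≗ᵇ {X} (λ _ → refl)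

  ≗ᵇ-sym : ∀ X Y → (X ≗ᵇ Y) ≡ true → (Y ≗ᵇ X) ≡ true
  ≗ᵇ-sym X Y X≗ᵇY = ≗⇒≗ᵇ (≗-sym (≗ᵇ⇒≗ X Y X≗ᵇY))

  ≗ᵇ-trans : ∀ X Y Z → (X ≗ᵇ Y) ≡ true → (Y ≗ᵇ Z) ≡ true → (X ≗ᵇ Z) ≡ true
  ≗ᵇ-trans X Y Z X≗ᵇY Y≗ᵇZ = ≗⇒≗ᵇ (≗-trans (≗ᵇ⇒≗ X Y X≗ᵇY) (≗ᵇ⇒≗ Y Z Y≗ᵇZ))

  ≗ᵇ-congˡ : ∀ {X X′} Y → X ≗ X′ → (X ≗ᵇ Y) ≡ (X′ ≗ᵇ Y)
  ≗ᵇ-congˡ Y X≗X′ = foldr-cong (λ r acc → cong (λ b → (b == Y r) ∧ acc) (X≗X′ r)) refl elems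

  ≗ᵇ-congʳ : ∀ X {Y Y′} → Y ≗ Y′ → (X ≗ᵇ Y) ≡ (X ≗ᵇ Y′)
  ≗ᵇ-congʳ X Y≗Y′ = foldr-cong (λ r acc → cong (λ b → (X r == b) ∧ acc) (Y≗Y′ r)) refl elems

module GroupRing (C : FiniteCoxeterSystem) where
  open FiniteCoxeterSystem C
  open Descents C

  group : Group 0ℓ 0ℓ
  group = record { Carrier = Carrier ; _≈_ = _≡_ ; _∙_ = _·_ ; ε = e ; _⁻¹ = _⁻¹ ; isGroup = isGroup }

  open GroupProperties group using (\\-leftDividesˡ; \\-leftDividesʳ)

  ∑-δ : ∀ u w (f : Carrier → ℤ) → ΣW (λ v → f v * ind (does ((u · v) ≟ w))) ≡ f (u ⁻¹ · w)
  ∑-δ u w f = trans (∑-single {f = term} (u ⁻¹ · w) unique (complete _) off) at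
    where
    term : Carrier → ℤ
    term v = f v * ind (does ((u · v) ≟ w))

    solve : ∀ v → u · v ≡ w → v ≡ u ⁻¹ · w
    solve v uv≡w = trans (sym (\\-leftDividesʳ u v)) (cong (u ⁻¹ ·_) uv≡w)

    off : ∀ v → v ≢ u ⁻¹ · w → term v ≡ 0ℤ
    off v v≢ rewrite dec-false ((u · v) ≟ w) (v≢ ∘ solve v) = *-zeroʳ (f v)

    at : term (u ⁻¹ · w) ≡ f (u ⁻¹ · w)
    at rewrite dec-true ((u · (u ⁻¹ · w)) ≟ w) (\\-leftDividesˡ u w) = *-identityʳ (f (u ⁻¹ · w))

  combination : (Carrier → ℤ) → (Carrier → ℤW) → ℤW
  combination c F x = ΣW λ y → (c y • F y) x

  ⊛-congˡ : ∀ {f f′} g → f ≈ f′ → (f ⊛ g) ≈ (f′ ⊛ g)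
  ⊛-congˡ g f≈f′ w = ∑-cong elems (λ u → cong (_* g (u ⁻¹ · w)) (f≈f′ u))

  ⊛-congʳ : ∀ f {g g′} → g ≈ g′ → (f ⊛ g) ≈ (f ⊛ g′)
  ⊛-congʳ f g≈g′ w = ∑-cong elems (λ u → cong (f u *_) (g≈g′ (u ⁻¹ · w)))

  ⊛-distribʳ-combination : ∀ c F g → (combination c F ⊛ g) ≈ combination c (λ y → F y ⊛ g)
  ⊛-distribʳ-combination c F g w = begin
    ΣW (λ u → ΣW (λ y → c y * F y u) * g (u ⁻¹ · w))
      ≡⟨ ∑-cong elems (λ u → ∑-*ʳ (g (u ⁻¹ · w)) elems (λ y → c y * F y u)) ⟩
    ΣW (λ u → ΣW (λ y → c y * F y u * g (u ⁻¹ · w)))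
      ≡⟨ ∑-comm elems elems (λ u y → c y * F y u * g (u ⁻¹ · w)) ⟩
    ΣW (λ y → ΣW (λ u → c y * F y u * g (u ⁻¹ · w)))
      ≡⟨ ∑-cong elems factor ⟩
    ΣW (λ y → c y * ΣW (λ u → F y u * g (u ⁻¹ · w)))
      ∎
    where
    factor : ∀ y → ΣW (λ u → c y * F y u * g (u ⁻¹ · w)) ≡ c y * ΣW (λ u → F y u * g (u ⁻¹ · w))
    factor y = trans (∑-cong elems (λ u → *-assoc (c y) (F y u) _))
                     (sym (∑-*ˡ (c y) elems (λ u → F y u * g (u ⁻¹ · w))))

  ⊛-distribˡ-combination : ∀ f c G → (f ⊛ combination c G) ≈ combination c (λ y → f ⊛ G y)
  ⊛-distribˡ-combination f c G w = begin
    ΣW (λ u → f u * ΣW (λ y → c y * G y (u ⁻¹ · w)))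
      ≡⟨ ∑-cong elems (λ u → ∑-*ˡ (f u) elems (λ y → c y * G y (u ⁻¹ · w))) ⟩
    ΣW (λ u → ΣW (λ y → f u * (c y * G y (u ⁻¹ · w))))
      ≡⟨ ∑-comm elems elems (λ u y → f u * (c y * G y (u ⁻¹ · w))) ⟩
    ΣW (λ y → ΣW (λ u → f u * (c y * G y (u ⁻¹ · w))))
      ≡⟨ ∑-cong elems factor ⟩
    ΣW (λ y → c y * ΣW (λ u → f u * G y (u ⁻¹ · w)))
      ∎
    where
    factor : ∀ y → ΣW (λ u → f u * (c y * G y (u ⁻¹ · w))) ≡ c y * ΣW (λ u → f u * G y (u ⁻¹ · w))
    factor y = trans (∑-cong elems (λ u → *-left-comm (f u) (c y) _))
                     (sym (∑-*ˡ (c y) elems (λ u → f u * G y (u ⁻¹ · w))))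

module DescentAlgebra (C : FiniteCoxeterSystem) (A : Descents.Subset C) where
  open FiniteCoxeterSystem C
  open Descents C
  open GroupRing C
  open SubsetEquality C

  ConstantOnDescentClasses : ℤW → Set
  ConstantOnDescentClasses f = ∀ w w′ → D A w ≗ D A w′ → f w ≡ f w′

  constant-resp-≈ : ∀ {f g} → f ≈ g → ConstantOnDescentClasses f → ConstantOnDescentClasses g
  constant-resp-≈ f≈g f-const w w′ Dw≗Dw′ = trans (sym (f≈g w)) (trans (f-const w w′ Dw≗Dw′) (f≈g w′))

  d-constant : ∀ K → ConstantOnDescentClasses (d A K)
  d-constant K w w′ Dw≗Dw′ = cong ind (≗ᵇ-congˡ K Dw≗Dw′)

  combination-constant : ∀ c F → (∀ y → ConstantOnDescentClasses (F y)) →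
                         ConstantOnDescentClasses (combination c F)
  combination-constant c F F-const w w′ Dw≗Dw′ =
    ∑-cong elems (λ y → cong (c y *_) (F-const y w w′ Dw≗Dw′))

  basis : Carrier → ℤW
  basis y = d A (D A y)

  In𝒟⇒constant : ∀ {f} → In𝒟 A f → ConstantOnDescentClasses f
  In𝒟⇒constant (c , f≈) =
    constant-resp-≈ (λ w → sym (f≈ w)) (combination-constant c basis (λ y → d-constant (D A y)))

  private
    sameDescents : Carrier → Carrier → Bool
    sameDescents w y = D A y ≗ᵇ D A w

    findRepresentative : ∀ w → ∃[ y ] findᵇ (sameDescents w) elems ≡ just y × sameDescents w y ≡ true
    findRepresentative w =
      findᵇ-just (sameDescents w) (Any.map (λ { refl → ≗ᵇ-refl (D A w) }) (complete w))

  representative : Carrier → Carrier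
  representative w = proj₁ (findRepresentative w)

  representative-descents : ∀ w → D A (representative w) ≗ D A w
  representative-descents w = ≗ᵇ⇒≗ _ _ (proj₂ (proj₂ (findRepresentative w)))

  representative-cong : ∀ {w w′} → D A w ≗ D A w′ → representative w ≡ representative w′
  representative-cong {w} {w′} Dw≗Dw′ = just-injective (begin
    just (representative w)            ≡⟨ sym (proj₁ (proj₂ (findRepresentative w))) ⟩
    findᵇ (sameDescents w) elems       ≡⟨ findᵇ-cong (λ y → ≗ᵇ-congʳ (D A y) Dw≗Dw′) elems ⟩
    findᵇ (sameDescents w′) elems      ≡⟨ proj₁ (proj₂ (findRepresentative w′)) ⟩
    just (representative w′)           ∎)

  constant⇒In𝒟 : ∀ {f} → ConstantOnDescentClasses f → In𝒟 A f
  constant⇒In𝒟 {f} f-const =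
    c , λ w → sym (trans (∑-single (representative w) unique (complete _) (off w)) (at w))
    where
    c : Carrier → ℤ
    c y = if does (representative y ≟ y) then f y else 0ℤ

    off : ∀ w y → y ≢ representative w → c y * basis y w ≡ 0ℤ
    off w y y≢rep with representative y ≟ y | inDI A (D A y) w in w∈
    ... | no  _      | _     = refl
    ... | yes _      | false = *-zeroʳ (f y)
    ... | yes rep≡y  | true  =
      ⊥-elim (y≢rep (trans (sym rep≡y) (representative-cong (≗-sym (≗ᵇ⇒≗ (D A w) (D A y) w∈)))))

    at : ∀ w → c (representative w) * basis (representative w) w ≡ f w
    at w rewrite dec-true (representative (representative w) ≟ representative w)
                          (representative-cong (representative-descents w))
               | ≗⇒≗ᵇ (≗-sym (representative-descents w))
      = trans (*-identityʳ _) (f-const _ _ (representative-descents w))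

  ⊛-closed⇒isSubalgebra : (∀ {f g} → In𝒟 A f → In𝒟 A g → In𝒟 A (f ⊛ g)) → IsSubalgebra (In𝒟 A)
  ⊛-closed⇒isSubalgebra ⊛-closed =
      (λ f≈g (c , f≈) → c , λ w → trans (sym (f≈g w)) (f≈ w))
    , constant⇒In𝒟 (λ _ _ _ → refl)
    , (λ f∈ g∈ → constant⇒In𝒟 λ w w′ Dw≗Dw′ →
         cong₂ _+_ (In𝒟⇒constant f∈ w w′ Dw≗Dw′) (In𝒟⇒constant g∈ w w′ Dw≗Dw′))
    , (λ a f∈ → constant⇒In𝒟 λ w w′ Dw≗Dw′ → cong (a *_) (In𝒟⇒constant f∈ w w′ Dw≗Dw′))
    , ⊛-closed

  module _ (I J : Subset) (w : Carrier) where

    IsFactorisation : Pred (Carrier × Carrier) 0ℓ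
    IsFactorisation p = inDI A I (proj₁ p) ≡ true × (inDI A J (proj₂ p) ≡ true × proj₁ p · proj₂ p ≡ w)

    factorisation-indicator : (P? : Decidable IsFactorisation) → ∀ u v →
                              ind (does (P? (u , v))) ≡ d A I u * (d A J v * ind (does ((u · v) ≟ w)))
    factorisation-indicator P? u v with inDI A I u in u∈I | inDI A J v in v∈J | (u · v) ≟ w
    ... | true  | true  | yes uv≡w = cong ind (dec-true (P? (u , v)) (u∈I , v∈J , uv≡w))
    ... | true  | true  | no  uv≢w = cong ind (dec-false (P? (u , v)) (uv≢w ∘ proj₂ ∘ proj₂))
    ... | true  | false | _        =
      cong ind (dec-false (P? (u , v)) λ (_ , v∈J′ , _) → case trans (sym v∈J) v∈J′ of λ ())
    ... | false | _     | _        =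
      cong ind (dec-false (P? (u , v)) λ (u∈I′ , _) → case trans (sym u∈I) u∈I′ of λ ())

    count-as-⊛ : (P? : Decidable IsFactorisation) →
                 + length (filter P? (cartesianProduct elems elems)) ≡ (d A I ⊛ d A J) w
    count-as-⊛ P? = begin
      + length (filter P? (cartesianProduct elems elems))
        ≡⟨ length-filter-∑ P? (cartesianProduct elems elems) ⟩
      ∑ (cartesianProduct elems elems) (λ p → ind (does (P? p)))
        ≡⟨ ∑-cartesianProduct elems elems (λ p → ind (does (P? p))) ⟩
      ΣW (λ u → ΣW (λ v → ind (does (P? (u , v)))))
        ≡⟨ ∑-cong elems (λ u → ∑-cong elems (factorisation-indicator P? u)) ⟩
      ΣW (λ u → ΣW (λ v → d A I u * (d A J v * ind (does ((u · v) ≟ w)))))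
        ≡⟨ ∑-cong elems (λ u → sym (∑-*ˡ (d A I u) elems _)) ⟩
      ΣW (λ u → d A I u * ΣW (λ v → d A J v * ind (does ((u · v) ≟ w))))
        ≡⟨ ∑-cong elems (λ u → cong (d A I u *_) (∑-δ u w (d A J))) ⟩
      ΣW (λ u → d A I u * d A J (u ⁻¹ · w))
        ∎

  -- countIJ filters with a decision procedure local to its where block; since count-as-⊛
  -- holds for every decision procedure, unification supplies that one.
  count≡⊛ : ∀ I J w → + countIJ A I J w ≡ (d A I ⊛ d A J) w
  count≡⊛ I J w = count-as-⊛ I J w _

  CountsConstantOnDescentClasses : Set
  CountsConstantOnDescentClasses = ∀ I J → IsAdmissible A I → IsAdmissible A J →
                                   ∀ w w′ → D A w ≗ D A w′ → countIJ A I J w ≡ countIJ A I J w′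

  ⊛-constant : CountsConstantOnDescentClasses → ∀ {I J} → IsAdmissible A I → IsAdmissible A J →
               ConstantOnDescentClasses (d A I ⊛ d A J)
  ⊛-constant counts {I} {J} I-adm J-adm w w′ Dw≗Dw′ = begin
    (d A I ⊛ d A J) w    ≡⟨ sym (count≡⊛ I J w) ⟩
    + countIJ A I J w    ≡⟨ cong +_ (counts I J I-adm J-adm w w′ Dw≗Dw′) ⟩
    + countIJ A I J w′   ≡⟨ count≡⊛ I J w′ ⟩
    (d A I ⊛ d A J) w′   ∎

  In𝒟-⊛-closed : CountsConstantOnDescentClasses → ∀ {f g} → In𝒟 A f → In𝒟 A g → In𝒟 A (f ⊛ g)
  In𝒟-⊛-closed counts {f} {g} (c , f≈) (c′ , g≈) =
    constant⇒In𝒟 (constant-resp-≈ (λ w → sym (expand w))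
      (combination-constant c _ λ y → combination-constant c′ _ λ y′ →
        ⊛-constant counts (y , λ _ → refl) (y′ , λ _ → refl)))
    where
    expand : (f ⊛ g) ≈ combination c (λ y → combination c′ (λ y′ → basis y ⊛ basis y′))
    expand w = begin
      (f ⊛ g) w                                ≡⟨ ⊛-congˡ g f≈ w ⟩
      (combination c basis ⊛ g) w              ≡⟨ ⊛-distribʳ-combination c basis g w ⟩
      combination c (λ y → basis y ⊛ g) w      ≡⟨ ∑-cong elems (λ y → cong (c y *_) (expandʳ y)) ⟩
      combination c (λ y → combination c′ (λ y′ → basis y ⊛ basis y′)) w ∎
      where
      expandʳ : ∀ y → (basis y ⊛ g) w ≡ combination c′ (λ y′ → basis y ⊛ basis y′) w
      expandʳ y = trans (⊛-congʳ (basis y) g≈ w) (⊛-distribˡ-combination (basis y) c′ basis w)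

  counts⇒isSubalgebra : CountsConstantOnDescentClasses → IsSubalgebra (In𝒟 A)
  counts⇒isSubalgebra counts = ⊛-closed⇒isSubalgebra (In𝒟-⊛-closed counts)

  isSubalgebra⇒counts : IsSubalgebra (In𝒟 A) → CountsConstantOnDescentClasses
  isSubalgebra⇒counts (_ , _ , _ , _ , ⊛-closed) I J _ _ w w′ Dw≗Dw′ = +-injective (begin
    + countIJ A I J w     ≡⟨ count≡⊛ I J w ⟩
    (d A I ⊛ d A J) w     ≡⟨ In𝒟⇒constant (⊛-closed (d∈𝒟 I) (d∈𝒟 J)) w w′ Dw≗Dw′ ⟩
    (d A I ⊛ d A J) w′    ≡⟨ sym (count≡⊛ I J w′) ⟩
    + countIJ A I J w′    ∎)
    where
    d∈𝒟 : ∀ K → In𝒟 A (d A K)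
    d∈𝒟 K = constant⇒In𝒟 (d-constant K)

  PadList-partition : ∀ w → ΣL (PadList A) (d A) w ≡ 1ℤ
  PadList-partition w =
    ∑-deduplicateᵇ-class _≗ᵇ_ (λ {X} {Y} → ≗ᵇ-sym X Y) (λ {X} {Y} {Z} → ≗ᵇ-trans X Y Z)
      (D A w) (map (D A) elems) (map⁺ (Any.map (λ { refl → ≗ᵇ-refl (D A w) }) (complete w)))

  constant-expansion : ∀ {h} → ConstantOnDescentClasses h →
                       (z : Subset → Carrier) → (∀ K → IsAdmissible A K → inDI A K (z K) ≡ true) →
                       h ≈ ΣL (PadList A) (λ K → h (z K) • d A K)
  constant-expansion {h} h-const z z∈ w = sym (begin
    ∑ (PadList A) (λ K → h (z K) * d A K w)  ≡⟨ ∑-cong (PadList A) coefficient ⟩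
    ∑ (PadList A) (λ K → h w * d A K w)      ≡⟨ sym (∑-*ˡ (h w) (PadList A) (λ K → d A K w)) ⟩
    h w * ΣL (PadList A) (d A) w             ≡⟨ cong (h w *_) (PadList-partition w) ⟩
    h w * 1ℤ                                 ≡⟨ *-identityʳ (h w) ⟩
    h w                                      ∎)
    where
    coefficient : ∀ K → h (z K) * d A K w ≡ h w * d A K w
    coefficient K with inDI A K w in w∈K
    ... | true  = cong (_* 1ℤ) (h-const (z K) w (≗-trans (≗ᵇ⇒≗ _ _ (z∈ K (w , K-desc))) (≗-sym K-desc)))
      where
      K-desc : D A w ≗ K
      K-desc = ≗ᵇ⇒≗ (D A w) K w∈K
    ... | false = trans (*-zeroʳ (h (z K))) (sym (*-zeroʳ (h w)))

lemma1p12 : (C : FiniteCoxeterSystem) →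
    let open FiniteCoxeterSystem C
        open Descents C
        Cond2 : Subset → Set
        Cond2 A = ∀ I J → IsAdmissible A I → IsAdmissible A J →
                  ∀ w w′ → D A w ≗ D A w′ → countIJ A I J w ≡ countIJ A I J w′
    in ∀ (A : Subset) → A ⊆T →
       (IsSubalgebra (In𝒟 A) ⇔ Cond2 A) ×
       (IsSubalgebra (In𝒟 A) → Cond2 A →
        ∀ (z : Subset → Carrier) → (∀ K → IsAdmissible A K → inDI A K (z K) ≡ true) →
        ∀ I J → IsAdmissible A I → IsAdmissible A J →
        (d A I ⊛ d A J) ≈ ΣL (PadList A) (λ K → (+ countIJ A I J (z K)) • d A K))
lemma1p12 C A _ =
    mk⇔ isSubalgebra⇒counts counts⇒isSubalgebra
  , λ _ counts z z∈ I J I-adm J-adm w →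
      trans (constant-expansion (⊛-constant counts I-adm J-adm) z z∈ w)
            (∑-cong (PadList A) (λ K → cong (_* d A K w) (sym (count≡⊛ I J (z K)))))
  where
  open Descents C
  open DescentAlgebra C A
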